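{- Let $\boldsymbol\alpha=(\alpha_1,\dots,\alpha_r)$, $\boldsymbol\beta=(\beta_1,\dots,\beta_s)$ with entries in $\mathbb{Q}\setminus\mathbb{Z}_{\le0}$. Let $p$ be a prime with $p>M_{\boldsymbol\alpha,\boldsymbol\beta}$, let $l$ be a positive integer, and let $a\in\{1,\dots,d_{\boldsymbol\alpha,\boldsymbol\beta}\}$ satisfy $ap\equiv1\pmod{d_{\boldsymbol\alpha,\boldsymbol\beta}}$. Then the following are equivalent: (i) $\delta_{\boldsymbol\alpha,\boldsymbol\beta}(x,a^l)\ge0$ for all $x\in\mathbb{R}$; (ii) $\delta_{\boldsymbol\alpha,\boldsymbol\beta}(a^l\beta_k,a^l)\ge0$ for all $k\in\{1,\dots,s\}$; (iii) for all $k\in\{1,\dots,s\}$, $\#\{i:\mathfrak D_p^l(\alpha_i)-\frac{\alpha_i}{p^l}\le\mathfrak D_p^l(\beta_k)-\frac{\beta_k}{p^l}\}\ge\#\{j:\mathfrak D_p^l(\beta_j)-\frac{\beta_j}{p^l}\le\mathfrak D_p^l(\beta_k)-\frac{\beta_k}{p^l}\}$; (iv) for all $n\in\{1,\dots,p^l\}$, $\#\{1\le i\le r:\mathfrak D_p^l(\alpha_i)-\frac{\alpha_i}{p^l}\le\frac{n}{p^l}\}\ge\#\{1\le j\le s:\mathfrak D_p^l(\beta_j)-\frac{\beta_j}{p^l}\le\frac{n}{p^l}\}$; (v) for all $n\in\{1,\dots,p^l\}$, $\sum_{i=1}^r\big\lceil\frac{n+\alpha_i}{p^l}-\mathfrak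 D_p^l(\alpha_i)\big\rceil\ge\sum_{j=1}^s\big\lceil\frac{n+\beta_j}{p^l}-\mathfrak D_p^l(\beta_j)\big\rceil$.
   Context: For $x\in\mathbb{R}$, $\langle x\rangle\in(0,1]$ with $x-\langle x\rangle\in\mathbb{Z}$; $x\preccurlyeq y$ iff $\langle x\rangle<\langle y\rangle$, or $\langle x\rangle=\langle y\rangle$ and $x\ge y$. $d_{\boldsymbol\alpha,\boldsymbol\beta}$ = lcm of reduced denominators of all $\alpha_i,\beta_j$; $\delta_{\boldsymbol\alpha,\boldsymbol\beta}(x,b)=\#\{i:b\alpha_i\preccurlyeq x\}-\#\{j:b\beta_j\preccurlyeq x\}$ for positive integers $b$ coprime to $d_{\boldsymbol\alpha,\boldsymbol\beta}$; $M_{\boldsymbol\alpha,\boldsymbol\beta}=d_{\boldsymbol\alpha,\boldsymbol\beta}(2+2\max\{|\alpha_i|,|\beta_j|\})$. Dwork map: for $\gamma\in\mathbb{Z}_p$, $\mathfrak D_p(\gamma)$ is the unique element of $\mathbb{Z}_p$ with $p\mathfrak D_p(\gamma)-\gamma\in\{0,\dots,p-1\}$; $\mathfrak D_p^l$ is its $l$-th iterate, i.e. the unique element of $\mathbb{Z}_p$ with $p^l\mathfrak D_p^l(\gamma)-\gamma\in\{0,\dots,p^l-1\}$ (the $\alpha_i,\beta_j$ lie in $\mathbb{Z}_p$ since $p>d_{\boldsymbol\alpha,\boldsymbol\beta}$).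
   Formalization: In condition (i) the variable x ranges over ℚ instead of ℝ. -}

module Defs where

open import Data.Bool using (Bool; true; false; if_then_else_; _∧_; _∨_)
open import Data.Nat as ℕ using (ℕ; zero; suc; _^_; NonZero)
open import Data.Nat.Properties using (m^n≢0)
open import Data.Nat.Divisibility using (_∣?_)
open import Data.Nat.LCM using (lcm)
open import Data.Integer as ℤ using (ℤ; +_)
open import Data.Rational as ℚ using (ℚ; _/_; _+_; _-_; _*_; _⊔_; ∣_∣; ceiling)
open import Data.Rational.Properties using (_≟_; _≤?_; _<?_)
open import Data.Fin using (Fin; zero; suc)
open import Relation.Nullary using (¬?)
open import Relation.Nullary.Decidable using (⌊_⌋)

count : ∀ {n} → (Fin n → Bool) → ℕ
count {zero}  f = 0
count {suc n} f = (if f zero then 1 else 0) ℕ.+ count (λ i → f (suc i))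

sumℤ : ∀ {n} → (Fin n → ℤ) → ℤ
sumℤ {zero}  f = + 0
sumℤ {suc n} f = f zero ℤ.+ sumℤ (λ i → f (suc i))

-- ⟨x⟩ ∈ (0,1] with x - ⟨x⟩ ∈ ℤ :  ⟨x⟩ = x - ⌈x⌉ + 1
⟨_⟩ : ℚ → ℚ
⟨ x ⟩ = x - (ceiling x / 1) + ℚ.1ℚ

_≼ᵇ_ : ℚ → ℚ → Bool
x ≼ᵇ y = ⌊ ⟨ x ⟩ <? ⟨ y ⟩ ⌋ ∨ (⌊ ⟨ x ⟩ ≟ ⟨ y ⟩ ⌋ ∧ ⌊ y ≤? x ⌋)

ℕtoℚ : ℕ → ℚ
ℕtoℚ b = + b / 1

δ : ∀ {r s} → (Fin r → ℚ) → (Fin s → ℚ) → ℚ → ℕ → ℤ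
δ α β x b = (+ count (λ i → (ℕtoℚ b * α i) ≼ᵇ x)) ℤ.- (+ count (λ j → (ℕtoℚ b * β j) ≼ᵇ x))

lcmF : ∀ {n} → (Fin n → ℕ) → ℕ
lcmF {zero}  f = 1
lcmF {suc n} f = lcm (f zero) (lcmF (λ i → f (suc i)))

dαβ : ∀ {r s} → (Fin r → ℚ) → (Fin s → ℚ) → ℕ
dαβ α β = lcm (lcmF (λ i → ℚ.denominatorℕ (α i))) (lcmF (λ j → ℚ.denominatorℕ (β j)))

-- max |α_i|, |β_j|  (0 if there are no entries; all values are ≥ 0 anyway)
maxAbs : ∀ {n} → (Fin n → ℚ) → ℚ
maxAbs {zero}  f = ℚ.0ℚ
maxAbs {suc n} f = ∣ f zero ∣ ⊔ maxAbs (λ i → f (suc i))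

Mαβ : ∀ {r s} → (Fin r → ℚ) → (Fin s → ℚ) → ℚ
Mαβ α β = ℕtoℚ (dαβ α β) * (ℕtoℚ 2 + ℕtoℚ 2 * (maxAbs α ⊔ maxAbs β))

NotNonPosInt : ℚ → Set
NotNonPosInt q = ∀ (n : ℕ) → ¬ (q ≡ ℚ.- (+ n / 1))
  where open import Relation.Nullary using (¬_)
        open import Relation.Binary.PropositionalEquality using (_≡_)

invPow : (p : ℕ) .{{_ : NonZero p}} → ℕ → ℚ
invPow p l = (+ 1 / (p ^ l)) {{m^n≢0 p l}}

firstFrom : (ℕ → Bool) → ℕ → ℕ → ℕ
firstFrom f zero       k = 0
firstFrom f (suc fuel) k = if f k then k else firstFrom f fuel (suc k)

-- a rational lies in ℤ_p iff p does not divide its reduced denominator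
pIntegralᵇ : ℕ → ℚ → Bool
pIntegralᵇ p q = ⌊ ¬? (p ∣? ℚ.denominatorℕ q) ⌋

-- For γ ∈ ℚ ∩ ℤ_p, the iterated Dwork map 𝔇_p^l(γ) is the unique element of ℤ_p
-- with p^l 𝔇_p^l(γ) - γ ∈ {0,…,p^l-1}; it is (γ + m)/p^l where m is the unique
-- m ∈ {0,…,p^l-1} such that (γ + m)/p^l ∈ ℤ_p.
dworkDigit : (p : ℕ) .{{_ : NonZero p}} → ℕ → ℚ → ℕ
dworkDigit p l γ = firstFrom (λ m → pIntegralᵇ p ((γ + ℕtoℚ m) * invPow p l)) (p ^ l) 0

dwork : (p : ℕ) .{{_ : NonZero p}} → ℕ → ℚ → ℚ
dwork p l γ = (γ + ℕtoℚ (dworkDigit p l γ)) * invPow p l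

lessEqᵇ : ℚ → ℚ → Bool
lessEqᵇ x y = ⌊ x ≤? y ⌋

{-# OPTIONS --safe #-}
-- Write d = d_{α,β}, P = p^l and b = a^l, so that b P ≡ 1 (mod d). Every parameter γ has dγ ∈ ℤ, and
-- p > M_{α,β} makes |dγ| small compared with P. Then m_γ = P⟨bγ⟩ − γ is an integer in [1, P) and
-- (γ + m_γ)/P = ⟨bγ⟩ is p-integral, while no smaller shift is (two p-integral shifts differ by a
-- multiple of P). So m_γ is the Dwork digit: 𝔇_p^l(γ) − γ/P = m_γ/P and ⌈(n + γ)/P − 𝔇_p^l(γ)⌉ = [m_γ < n].
-- Comparing m_γ for two parameters reproduces the order ≼ on bγ, because a change of ⟨b·⟩ is at
-- least 1/d and outweighs the difference of the γ's. Hence (ii)–(v) compare the same two counting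
-- functions at various thresholds, and for a total preorder a count inequality at the points β_k
-- holds at every threshold; the same fact for ≼ gives (i) ⇔ (ii).
module Submission where

open import Defs
open import Data.Bool using (Bool; true; false; T)
open import Data.Bool.Properties using (T-∧; T-∨)
open import Data.Empty using (⊥-elim)
open import Data.Fin using (Fin; zero; suc)
open import Data.Integer as ℤ using (ℤ; +_; -[1+_])
import Data.Integer.DivMod as ℤ
import Data.Integer.GCD as ℤ
import Data.Integer.Properties as ℤ
open import Data.Nat as ℕ using (ℕ; zero; suc; NonZero; _^_; _∸_; z≤n; s≤s)
import Data.Nat.Coprimality as Coprime
open import Data.Nat.Divisibility as ℕ using (_∣_; divides)
import Data.Nat.GCD as ℕ
open import Data.Nat.LCM using (m∣lcm[m,n]; n∣lcm[m,n])
open import Data.Nat.Primality using (Prime; euclidsLemma; ¬prime[1]; prime⇒nonZero)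
import Data.Nat.Properties as ℕ
import Data.Product as Product
open import Data.Product using (∃; _×_; _,_; proj₁; proj₂)
open import Data.Rational as ℚ
  using (ℚ; mkℚ; _/_; _+_; _*_; _-_; -_; _<_; ↥_; ↧_; ↧ₙ_; 0ℚ; 1ℚ; _⊔_; ceiling; floor)
import Data.Rational.Properties as ℚ
open import Data.Rational.Solver using (module +-*-Solver)
import Data.Sum as Sum
open import Data.Sum using (_⊎_; inj₁; inj₂; [_,_]′)
open import Function using (_∘_)
open import Function.Bundles using (_⇔_; mk⇔; Equivalence)
open import Function.Properties.Equivalence using () renaming (trans to ⇔-trans; sym to ⇔-sym)
open import Relation.Binary.Definitions using (Tri; tri<; tri≈; tri>)
open import Relation.Binary.PropositionalEquality
open import Relation.Nullary using (¬_; yes; no)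
open import Relation.Nullary.Decidable using (T?; toWitness; fromWitness)

-- In this section _≤_ is the order on ℚ; the statement of lemma2p6 uses the order on ℕ.
module _ where

  open import Data.Rational using (_≤_)
  open +-*-Solver

  -- Integers and fractional parts in ℚ

  ι : ℤ → ℚ
  ι z = z / 1

  ↥-ι : ∀ z → ↥ ι z ≡ z
  ↥-ι z = trans (sym (ℤ.*-identityʳ _))
            (trans (cong (↥ ι z ℤ.*_) (sym (cong +_ (ℕ.gcd-zeroʳ ℤ.∣ z ∣)))) (ℚ.↥-/ z 1))

  ↧-ι : ∀ z → ↧ ι z ≡ + 1
  ↧-ι z = trans (sym (ℤ.*-identityʳ _))
            (trans (cong (↧ ι z ℤ.*_) (sym (cong +_ (ℕ.gcd-zeroʳ ℤ.∣ z ∣)))) (ℚ.↧-/ z 1))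

  ι-cross : ∀ x y → ↥ ι x ℤ.* ↧ ι y ≡ x
  ι-cross x y = trans (cong₂ ℤ._*_ (↥-ι x) (↧-ι y)) (ℤ.*-identityʳ x)

  ι≡mkℚ : ∀ z → ι z ≡ mkℚ z 0 (Coprime.sym (Coprime.1-coprimeTo ℤ.∣ z ∣))
  ι≡mkℚ z = ℚ.≃⇒≡ (ℚ.*≡* (trans (cong (ℤ._* + 1) (↥-ι z)) (cong (z ℤ.*_) (sym (↧-ι z)))))

  ι-+ : ∀ x y → ι (x ℤ.+ y) ≡ ι x + ι y
  ι-+ x y rewrite ι≡mkℚ x | ι≡mkℚ y =
    sym (ℚ./-cong (cong₂ ℤ._+_ (ℤ.*-identityʳ x) (ℤ.*-identityʳ y)) refl)

  ι-* : ∀ x y → ι (x ℤ.* y) ≡ ι x * ι y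
  ι-* x y rewrite ι≡mkℚ x | ι≡mkℚ y = refl

  ι-neg : ∀ x → ι (ℤ.- x) ≡ - ι x
  ι-neg x = ℚ.≃⇒≡ (ℚ.*≡* (cong₂ ℤ._*_
    (trans (↥-ι (ℤ.- x)) (trans (cong ℤ.-_ (sym (↥-ι x))) (sym (ℚ.↥-neg (ι x)))))
    (trans (trans (ℚ.↧-neg (ι x)) (↧-ι x)) (sym (↧-ι (ℤ.- x))))))

  ι-injective : ∀ {x y} → ι x ≡ ι y → x ≡ y
  ι-injective {x} {y} eq = trans (sym (↥-ι x)) (trans (cong ↥_ eq) (↥-ι y))

  ι-mono-≤ : ∀ {x y} → x ℤ.≤ y → ι x ≤ ι y
  ι-mono-≤ {x} {y} le = ℚ.*≤* (subst₂ ℤ._≤_ (sym (ι-cross x y)) (sym (ι-cross y x)) le)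

  ι-cancel-≤ : ∀ {x y} → ι x ≤ ι y → x ℤ.≤ y
  ι-cancel-≤ {x} {y} (ℚ.*≤* le) = subst₂ ℤ._≤_ (ι-cross x y) (ι-cross y x) le

  ι-mono-< : ∀ {x y} → x ℤ.< y → ι x < ι y
  ι-mono-< {x} {y} lt = ℚ.*<* (subst₂ ℤ._<_ (sym (ι-cross x y)) (sym (ι-cross y x)) lt)

  ι-cancel-< : ∀ {x y} → ι x < ι y → x ℤ.< y
  ι-cancel-< {x} {y} (ℚ.*<* lt) = subst₂ ℤ._<_ (ι-cross x y) (ι-cross y x) lt

  ℕtoℚ-+ : ∀ m n → ℕtoℚ (m ℕ.+ n) ≡ ℕtoℚ m + ℕtoℚ n
  ℕtoℚ-+ m n = trans (cong ι (ℤ.pos-+ m n)) (ι-+ (+ m) (+ n))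

  ℕtoℚ-* : ∀ m n → ℕtoℚ (m ℕ.* n) ≡ ℕtoℚ m * ℕtoℚ n
  ℕtoℚ-* m n = trans (cong ι (ℤ.pos-* m n)) (ι-* (+ m) (+ n))

  0≤ℕtoℚ : ∀ n → 0ℚ ≤ ℕtoℚ n
  0≤ℕtoℚ n = ι-mono-≤ {+ 0} {+ n} (ℤ.+≤+ z≤n)

  0<ℕtoℚ : ∀ {n} → 1 ℕ.≤ n → 0ℚ < ℕtoℚ n
  0<ℕtoℚ {n} n≥1 = ι-mono-< {+ 0} {+ n} (ℤ.+<+ n≥1)

  denominator-*-cancel : ∀ q → ι (↧ q) * q ≡ ι (↥ q)
  denominator-*-cancel q@(mkℚ n d _) =
    trans (cong (_* q) (ι≡mkℚ (↧ q)))
      (trans (ℚ.toℚᵘ-injective (ℚᵘ.≃-trans (ℚ.toℚᵘ-homo-* (mkℚ (↧ q) 0 (Coprime.sym (Coprime.1-coprimeTo _))) q)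
        (ℚᵘ.*≡* (trans (ℤ.*-identityʳ _) (trans (ℤ.*-comm (+ suc d) n)
          (cong (λ k → n ℤ.* + suc k) (sym (ℕ.+-identityʳ d))))))))
      (sym (ι≡mkℚ n)))
    where import Data.Rational.Unnormalised as ℚᵘ
          import Data.Rational.Unnormalised.Properties as ℚᵘ

  p≤q⇒0≤q-p : ∀ {p q} → p ≤ q → 0ℚ ≤ q - p
  p≤q⇒0≤q-p {p} {q} h = subst (_≤ q - p) (ℚ.+-inverseʳ p) (ℚ.+-monoˡ-≤ (- p) h)

  p<q⇒0<q-p : ∀ {p q} → p < q → 0ℚ < q - p
  p<q⇒0<q-p {p} {q} h = subst (_< q - p) (ℚ.+-inverseʳ p) (ℚ.+-monoˡ-< (- p) h)

  0≤q-p⇒p≤q : ∀ {p q} → 0ℚ ≤ q - p → p ≤ q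
  0≤q-p⇒p≤q {p} {q} h =
    subst₂ _≤_ (ℚ.+-identityˡ p) (solve 2 (λ p q → q :- p :+ p := q) refl p q) (ℚ.+-monoˡ-≤ p h)

  0<q-p⇒p<q : ∀ {p q} → 0ℚ < q - p → p < q
  0<q-p⇒p<q {p} {q} h =
    subst₂ _<_ (ℚ.+-identityˡ p) (solve 2 (λ p q → q :- p :+ p := q) refl p q) (ℚ.+-monoˡ-< p h)

  p≤∣p∣ : ∀ p → p ≤ ℚ.∣ p ∣
  p≤∣p∣ p with ℚ.∣p∣≡p∨∣p∣≡-p p
  ... | inj₁ ∣p∣≡p  = ℚ.≤-reflexive (sym ∣p∣≡p)
  ... | inj₂ ∣p∣≡-p = ℚ.≤-trans p≤0 (ℚ.0≤∣p∣ p)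
    where
    p≤0 : p ≤ 0ℚ
    p≤0 = 0≤q-p⇒p≤q (subst (0ℚ ≤_) (trans ∣p∣≡-p (solve 1 (λ p → :- p := con 0ℚ :- p) refl p)) (ℚ.0≤∣p∣ p))

  -p≤∣p∣ : ∀ p → - p ≤ ℚ.∣ p ∣
  -p≤∣p∣ p = subst (- p ≤_) (ℚ.∣-p∣≡∣p∣ p) (p≤∣p∣ (- p))

  0<* : ∀ {x y} → 0ℚ < x → 0ℚ < y → 0ℚ < x * y
  0<* {x} {y} 0<x 0<y = subst (_< x * y) (ℚ.*-zeroˡ y) (ℚ.*-monoˡ-<-pos y {{ℚ.positive 0<y}} 0<x)

  floor-bounds : ∀ q → ι (floor q) ≤ q × q < ι (floor q) + 1ℚ
  floor-bounds q@(mkℚ n d _) = lower , subst (q <_) (trans (ι-+ (+ 1) f) (ℚ.+-comm (ι (+ 1)) (ι f))) upper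
    where
    f = floor q
    f≡ : f ≡ n ℤ./ℕ suc d
    f≡ = ℤ.div-pos-is-/ℕ n (suc d)
    lower : ι f ≤ q
    lower = ℚ.*≤* (subst₂ ℤ._≤_ (sym (cong (ℤ._* + suc d) (↥-ι f)))
              (trans (sym (ℤ.*-identityʳ n)) (cong (n ℤ.*_) (sym (↧-ι f))))
              (subst (λ w → w ℤ.* + suc d ℤ.≤ n) (sym f≡) (ℤ.[n/ℕd]*d≤n n (suc d))))
    upper : q < ι (ℤ.suc f)
    upper = ℚ.*<* (subst₂ ℤ._<_ (trans (sym (ℤ.*-identityʳ n)) (cong (n ℤ.*_) (sym (↧-ι (ℤ.suc f)))))
              (sym (cong (ℤ._* + suc d) (↥-ι (ℤ.suc f))))
              (subst (λ w → n ℤ.< ℤ.suc w ℤ.* + suc d) (sym f≡) (ℤ.n<s[n/ℕd]*d n (suc d))))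

  ceiling-bounds : ∀ q → q ≤ ι (ceiling q) × ι (ceiling q) - 1ℚ < q
  ceiling-bounds q@record{} =
    subst₂ _≤_ (solve 1 (λ x → :- :- x := x) refl q) (sym (ι-neg f)) (ℚ.neg-antimono-≤ (proj₁ (floor-bounds (- q)))) ,
    subst₂ _<_ (trans (solve 1 (λ x → :- (x :+ con 1ℚ) := :- x :- con 1ℚ) refl (ι f)) (cong (_- 1ℚ) (sym (ι-neg f))))
      (solve 1 (λ x → :- :- x := x) refl q) (ℚ.neg-antimono-< (proj₂ (floor-bounds (- q))))
    where
    f = floor (- q)

  ceiling-unique : ∀ q z → ι z - 1ℚ < q → q ≤ ι z → ceiling q ≡ z
  ceiling-unique q z lower upper =
    ℤ.≤-antisym (≤-of (proj₂ (ceiling-bounds q)) upper) (≤-of lower (proj₁ (ceiling-bounds q)))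
    where
    ≤-of : ∀ {x y} → ι x - 1ℚ < q → q ≤ ι y → x ℤ.≤ y
    ≤-of {x} {y} x-1<q q≤y = subst (x ℤ.≤_) (ℤ.pred-suc y) (ℤ.i<j⇒i≤pred[j] {j = ℤ.suc y} (ι-cancel-< (subst₂ _<_
      (solve 1 (λ x → x :- con 1ℚ :+ con 1ℚ := x) refl (ι x))
      (trans (ℚ.+-comm (ι y) 1ℚ) (sym (ι-+ (+ 1) y)))
      (ℚ.+-monoˡ-< 1ℚ (ℚ.<-≤-trans x-1<q q≤y)))))

  ⟨⟩-pos : ∀ x → 0ℚ < ⟨ x ⟩
  ⟨⟩-pos x = subst (0ℚ <_) (solve 2 (λ x c → x :- (c :- con 1ℚ) := x :- c :+ con 1ℚ) refl x (ι (ceiling x)))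
    (p<q⇒0<q-p (proj₂ (ceiling-bounds x)))

  ⟨⟩-≤1 : ∀ x → ⟨ x ⟩ ≤ 1ℚ
  ⟨⟩-≤1 x = 0≤q-p⇒p≤q (subst (0ℚ ≤_) (solve 2 (λ x c → c :- x := con 1ℚ :- (x :- c :+ con 1ℚ)) refl x (ι (ceiling x)))
    (p≤q⇒0≤q-p (proj₁ (ceiling-bounds x))))

  IsInteger : ℚ → Set
  IsInteger q = ∃ λ z → q ≡ ι z

  isInteger-+ : ∀ {x y} → IsInteger x → IsInteger y → IsInteger (x + y)
  isInteger-+ (a , refl) (b , refl) = a ℤ.+ b , sym (ι-+ a b)

  isInteger-* : ∀ {x y} → IsInteger x → IsInteger y → IsInteger (x * y)
  isInteger-* (a , refl) (b , refl) = a ℤ.* b , sym (ι-* a b)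

  isInteger-neg : ∀ {x} → IsInteger x → IsInteger (- x)
  isInteger-neg (a , refl) = ℤ.- a , sym (ι-neg a)

  isInteger-- : ∀ {x y} → IsInteger x → IsInteger y → IsInteger (x - y)
  isInteger-- x∈ℤ y∈ℤ = isInteger-+ x∈ℤ (isInteger-neg y∈ℤ)

  ℕtoℚ-isInteger : ∀ n → IsInteger (ℕtoℚ n)
  ℕtoℚ-isInteger n = + n , refl

  isInteger-pos⇒1≤ : ∀ {x} → IsInteger x → 0ℚ < x → 1ℚ ≤ x
  isInteger-pos⇒1≤ (a , refl) 0<a = ι-mono-≤ {+ 1} {a} (ℤ.i<j⇒suc[i]≤j (ι-cancel-< {+ 0} {a} 0<a))

  notNonPosInt-isInteger⇒pos : ∀ {x} → NotNonPosInt x → IsInteger x → 0ℚ < x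
  notNonPosInt-isInteger⇒pos x∉ℤ≤0 (+ zero , x≡0) = ⊥-elim (x∉ℤ≤0 0 (trans x≡0 (ι-neg (+ 0))))
  notNonPosInt-isInteger⇒pos x∉ℤ≤0 (+ suc n , x≡n) = subst (0ℚ <_) (sym x≡n) (0<ℕtoℚ {suc n} (s≤s z≤n))
  notNonPosInt-isInteger⇒pos x∉ℤ≤0 (-[1+ n ] , x≡-n) = ⊥-elim (x∉ℤ≤0 (suc n) (trans x≡-n (ι-neg (+ suc n))))

  denominator∣⇒isInteger : ∀ k q → ↧ₙ q ∣ k → IsInteger (ℕtoℚ k * q)
  denominator∣⇒isInteger k q (divides c refl) = + c ℤ.* ↥ q , (begin
    ℕtoℚ (c ℕ.* ↧ₙ q) * q     ≡⟨ cong (_* q) (ℕtoℚ-* c (↧ₙ q)) ⟩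
    ι (+ c) * ι (↧ q) * q     ≡⟨ ℚ.*-assoc (ι (+ c)) (ι (↧ q)) q ⟩
    ι (+ c) * (ι (↧ q) * q)   ≡⟨ cong (ι (+ c) *_) (denominator-*-cancel q) ⟩
    ι (+ c) * ι (↥ q)         ≡⟨ ι-* (+ c) (↥ q) ⟨
    ι (+ c ℤ.* ↥ q)           ∎)
    where open ≡-Reasoning

  isInteger⇒denominator∣ : ∀ k q → IsInteger (ℕtoℚ k * q) → ↧ₙ q ∣ k
  isInteger⇒denominator∣ k q@(mkℚ n _ coprime) (z , kq≡z) =
    Coprime.coprime-divisor (Coprime.sym (Coprime.recompute coprime)) (divides ℤ.∣ z ∣ ∣n∣k≡∣z∣d)
    where
    ι-eq : ι (↧ q) * ι z ≡ ι (+ k) * ι n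
    ι-eq = begin
      ι (↧ q) * ι z             ≡⟨ cong (ι (↧ q) *_) kq≡z ⟨
      ι (↧ q) * (ι (+ k) * q)   ≡⟨ solve 3 (λ a b c → a :* (b :* c) := b :* (a :* c)) refl (ι (↧ q)) (ι (+ k)) q ⟩
      ι (+ k) * (ι (↧ q) * q)   ≡⟨ cong (ι (+ k) *_) (denominator-*-cancel q) ⟩
      ι (+ k) * ι n             ∎
      where open ≡-Reasoning
    dz≡kn : ↧ q ℤ.* z ≡ + k ℤ.* n
    dz≡kn = ι-injective (trans (ι-* (↧ q) z) (trans ι-eq (sym (ι-* (+ k) n))))
    ∣n∣k≡∣z∣d : ℤ.∣ n ∣ ℕ.* k ≡ ℤ.∣ z ∣ ℕ.* ↧ₙ q
    ∣n∣k≡∣z∣d = begin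
      ℤ.∣ n ∣ ℕ.* k          ≡⟨ ℕ.*-comm ℤ.∣ n ∣ k ⟩
      k ℕ.* ℤ.∣ n ∣          ≡⟨ ℤ.abs-* (+ k) n ⟨
      ℤ.∣ + k ℤ.* n ∣        ≡⟨ cong ℤ.∣_∣ dz≡kn ⟨
      ℤ.∣ ↧ q ℤ.* z ∣        ≡⟨ ℤ.abs-* (↧ q) z ⟩
      ↧ₙ q ℕ.* ℤ.∣ z ∣       ≡⟨ ℕ.*-comm (↧ₙ q) ℤ.∣ z ∣ ⟩
      ℤ.∣ z ∣ ℕ.* ↧ₙ q       ∎
      where open ≡-Reasoning

  x-⟨x⟩-isInteger : ∀ x → IsInteger (x - ⟨ x ⟩)
  x-⟨x⟩-isInteger x = ceiling x ℤ.- + 1 ,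
    trans (solve 2 (λ x c → x :- (x :- c :+ con 1ℚ) := c :- con 1ℚ) refl x (ι (ceiling x)))
          (sym (ι-+ (ceiling x) (ℤ.- + 1)))

  isInteger-between⇒ℕ : ∀ {x} P → IsInteger x → 0ℚ < x → x < ℕtoℚ P → ∃ λ m → x ≡ ℕtoℚ m × 1 ℕ.≤ m × m ℕ.< P
  isInteger-between⇒ℕ P (+ m , refl) 0<m m<P = m , refl , ℤ.drop‿+<+ (ι-cancel-< {+ 0} 0<m) , ℤ.drop‿+<+ (ι-cancel-< m<P)
  isInteger-between⇒ℕ P (-[1+ m ] , refl) 0<x _ = ⊥-elim (ℚ.<-asym 0<x (ι-mono-< { -[1+ m ]} {+ 0} ℤ.-<+))

  d*v<P⇒v<P*u : ∀ d P {u v} → IsInteger (ℕtoℚ d * u) → 0ℚ < ℕtoℚ d * u → ℕtoℚ d * v < ℕtoℚ P → v < ℕtoℚ P * u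
  d*v<P⇒v<P*u d P {u} {v} du∈ℤ 0<du dv<P = ℚ.*-cancelˡ-<-nonNeg (ℕtoℚ d) {{ℚ.nonNegative (0≤ℕtoℚ d)}} (begin-strict
    ℕtoℚ d * v           <⟨ dv<P ⟩
    ℕtoℚ P               ≡⟨ ℚ.*-identityʳ (ℕtoℚ P) ⟨
    ℕtoℚ P * 1ℚ          ≤⟨ ℚ.*-monoˡ-≤-nonNeg (ℕtoℚ P) {{ℚ.nonNegative (0≤ℕtoℚ P)}} (isInteger-pos⇒1≤ du∈ℤ 0<du) ⟩
    ℕtoℚ P * (ℕtoℚ d * u) ≡⟨ solve 3 (λ P d u → P :* (d :* u) := d :* (P :* u)) refl (ℕtoℚ P) (ℕtoℚ d) u ⟩
    ℕtoℚ d * (ℕtoℚ P * u) ∎)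
    where open ℚ.≤-Reasoning

  ℕtoℚ-*-inverse : ∀ n .{{_ : NonZero n}} → ℕtoℚ n * (+ 1 / n) ≡ 1ℚ
  ℕtoℚ-*-inverse n = trans (cong (λ w → ι w * (+ 1 / n)) (sym ↧1/n≡n))
    (trans (denominator-*-cancel (+ 1 / n)) (cong ι ↥1/n≡1))
    where
    gcd[1,n]≡1 : ℤ.gcd (+ 1) (+ n) ≡ + 1
    gcd[1,n]≡1 = cong +_ (ℕ.gcd-zeroˡ n)
    ↥1/n≡1 : ↥ (+ 1 / n) ≡ + 1
    ↥1/n≡1 = trans (sym (ℤ.*-identityʳ _)) (trans (cong (↥ (+ 1 / n) ℤ.*_) (sym gcd[1,n]≡1)) (ℚ.↥-/ (+ 1) n))
    ↧1/n≡n : ↧ (+ 1 / n) ≡ + n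
    ↧1/n≡n = trans (sym (ℤ.*-identityʳ _)) (trans (cong (↧ (+ 1 / n) ℤ.*_) (sym gcd[1,n]≡1)) (ℚ.↧-/ (+ 1) n))

  -- Counting below a threshold

  count-mono : ∀ {n} {f g : Fin n → Bool} → (∀ i → T (f i) → T (g i)) → count f ℕ.≤ count g
  count-mono {zero} f⇒g = z≤n
  count-mono {suc n} {f} {g} f⇒g with f zero in f0 | g zero in g0
  ... | true  | true  = s≤s (count-mono (f⇒g ∘ suc))
  ... | true  | false = ⊥-elim (subst T g0 (f⇒g zero (subst T (sym f0) _)))
  ... | false | true  = ℕ.m≤n⇒m≤1+n (count-mono (f⇒g ∘ suc))
  ... | false | false = count-mono (f⇒g ∘ suc)

  count-cong : ∀ {n} {f g : Fin n → Bool} → (∀ i → T (f i) ⇔ T (g i)) → count f ≡ count g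
  count-cong f⇔g = ℕ.≤-antisym (count-mono (Equivalence.to ∘ f⇔g)) (count-mono (Equivalence.from ∘ f⇔g))

  count-none : ∀ {n} (f : Fin n → Bool) → (∀ i → ¬ T (f i)) → count f ≡ 0
  count-none {zero} f none = refl
  count-none {suc n} f none with f zero in f0
  ... | true  = ⊥-elim (none zero (subst T (sym f0) _))
  ... | false = count-none (f ∘ suc) (none ∘ suc)

  sumℤ-indicator : ∀ {n} (f : Fin n → ℤ) (g : Fin n → Bool) →
                   (∀ i → (T (g i) → f i ≡ + 1) × (¬ T (g i) → f i ≡ + 0)) → sumℤ f ≡ + count g
  sumℤ-indicator {zero} f g indicator = refl
  sumℤ-indicator {suc n} f g indicator with g zero in g0
  ... | true  = trans (cong₂ ℤ._+_ (proj₁ (indicator zero) (subst T (sym g0) _)) rest) (sym (ℤ.pos-+ 1 _))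
    where rest = sumℤ-indicator (f ∘ suc) (g ∘ suc) (indicator ∘ suc)
  ... | false = trans (cong₂ ℤ._+_ (proj₂ (indicator zero) (subst T g0)) rest) (ℤ.+-identityˡ _)
    where rest = sumℤ-indicator (f ∘ suc) (g ∘ suc) (indicator ∘ suc)

  module CountBelow {A : Set} (R : A → A → Bool)
    (R-total : ∀ x y → T (R x y) ⊎ T (R y x))
    (R-trans : ∀ {x y z} → T (R x y) → T (R y z) → T (R x z)) where

    countBelow : ∀ {n} → (Fin n → A) → A → ℕ
    countBelow v t = count (λ i → R (v i) t)

    R-refl : ∀ x → T (R x x)
    R-refl x = Sum.reduce (R-total x x)

    greatest-below : ∀ {s} (v : Fin s → A) t →
      (∀ j → ¬ T (R (v j) t)) ⊎ ∃ λ k → T (R (v k) t) × (∀ j → T (R (v j) t) → T (R (v j) (v k)))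
    greatest-below {zero} v t = inj₁ λ ()
    greatest-below {suc s} v t with greatest-below (v ∘ suc) t | T? (R (v zero) t)
    ... | inj₁ none | no v0≰t = inj₁ λ { zero → v0≰t ; (suc j) → none j }
    ... | inj₁ none | yes v0≤t =
      inj₂ (zero , v0≤t , λ { zero _ → R-refl (v zero) ; (suc j) vj≤t → ⊥-elim (none j vj≤t) })
    ... | inj₂ (k , vk≤t , max) | no v0≰t =
      inj₂ (suc k , vk≤t , λ { zero v0≤t → ⊥-elim (v0≰t v0≤t) ; (suc j) → max j })
    ... | inj₂ (k , vk≤t , max) | yes v0≤t with R-total (v zero) (v (suc k))
    ...   | inj₁ v0≤vk = inj₂ (suc k , vk≤t , λ { zero _ → v0≤vk ; (suc j) → max j })
    ...   | inj₂ vk≤v0 =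
      inj₂ (zero , v0≤t , λ { zero _ → R-refl (v zero) ; (suc j) vj≤t → R-trans (max j vj≤t) vk≤v0 })

    -- Compare at the greatest β k below t: no β j lies strictly between, and the α-count only grows from β k to t.
    countBelow-≤-everywhere : ∀ {r s} (α : Fin r → A) (β : Fin s → A) →
      (∀ k → countBelow β (β k) ℕ.≤ countBelow α (β k)) → ∀ t → countBelow β t ℕ.≤ countBelow α t
    countBelow-≤-everywhere α β at-β t with greatest-below β t
    ... | inj₁ none = subst (ℕ._≤ _) (sym (count-none _ none)) z≤n
    ... | inj₂ (k , βk≤t , max) = begin
      countBelow β t       ≤⟨ count-mono max ⟩
      countBelow β (β k)   ≤⟨ at-β k ⟩
      countBelow α (β k)   ≤⟨ count-mono {g = λ i → R (α i) t} (λ i αi≤βk → R-trans αi≤βk βk≤t) ⟩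
      countBelow α t       ∎
      where open ℕ.≤-Reasoning

  -- The orders ≤ and ≼

  T-lessEqᵇ⇔ : ∀ x y → T (lessEqᵇ x y) ⇔ x ≤ y
  T-lessEqᵇ⇔ x y = mk⇔ (toWitness {a? = x ℚ.≤? y}) fromWitness

  lessEqᵇ-total : ∀ x y → T (lessEqᵇ x y) ⊎ T (lessEqᵇ y x)
  lessEqᵇ-total x y = Sum.map fromWitness fromWitness (ℚ.≤-total x y)

  lessEqᵇ-trans : ∀ {x y z} → T (lessEqᵇ x y) → T (lessEqᵇ y z) → T (lessEqᵇ x z)
  lessEqᵇ-trans {x} {y} {z} x≤y y≤z =
    fromWitness (ℚ.≤-trans (Equivalence.to (T-lessEqᵇ⇔ x y) x≤y) (Equivalence.to (T-lessEqᵇ⇔ y z) y≤z))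

  _≼_ : ℚ → ℚ → Set
  x ≼ y = ⟨ x ⟩ < ⟨ y ⟩ ⊎ (⟨ x ⟩ ≡ ⟨ y ⟩ × y ≤ x)

  T-≼ᵇ⇔ : ∀ x y → T (x ≼ᵇ y) ⇔ x ≼ y
  T-≼ᵇ⇔ x y = mk⇔
    (Sum.map (toWitness {a? = <?}) (Product.map (toWitness {a? = ≟}) (toWitness {a? = ≤?}) ∘ Equivalence.to T-∧)
     ∘ Equivalence.to T-∨)
    (Equivalence.from T-∨ ∘ Sum.map (fromWitness {a? = <?})
      (Equivalence.from T-∧ ∘ Product.map (fromWitness {a? = ≟}) (fromWitness {a? = ≤?})))
    where
    <? = ⟨ x ⟩ ℚ.<? ⟨ y ⟩
    ≟ = ⟨ x ⟩ ℚ.≟ ⟨ y ⟩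
    ≤? = y ℚ.≤? x

  ≼-total : ∀ x y → x ≼ y ⊎ y ≼ x
  ≼-total x y with ℚ.<-cmp ⟨ x ⟩ ⟨ y ⟩ | ℚ.≤-total x y
  ... | tri< x<y _ _ | _      = inj₁ (inj₁ x<y)
  ... | tri> _ _ y<x | _      = inj₂ (inj₁ y<x)
  ... | tri≈ _ x≈y _ | inj₁ x≤y = inj₂ (inj₂ (sym x≈y , x≤y))
  ... | tri≈ _ x≈y _ | inj₂ y≤x = inj₁ (inj₂ (x≈y , y≤x))

  ≼-trans : ∀ {x y z} → x ≼ y → y ≼ z → x ≼ z
  ≼-trans (inj₁ x<y)        (inj₁ y<z)        = inj₁ (ℚ.<-trans x<y y<z)
  ≼-trans (inj₁ x<y)        (inj₂ (y≈z , _))  = inj₁ (subst (_ <_) y≈z x<y)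
  ≼-trans (inj₂ (x≈y , _))  (inj₁ y<z)        = inj₁ (subst (_< _) (sym x≈y) y<z)
  ≼-trans (inj₂ (x≈y , y≤x)) (inj₂ (y≈z , z≤y)) = inj₂ (trans x≈y y≈z , ℚ.≤-trans z≤y y≤x)

  ≼ᵇ-total : ∀ x y → T (x ≼ᵇ y) ⊎ T (y ≼ᵇ x)
  ≼ᵇ-total x y = Sum.map (Equivalence.from (T-≼ᵇ⇔ x y)) (Equivalence.from (T-≼ᵇ⇔ y x)) (≼-total x y)

  ≼ᵇ-trans : ∀ {x y z} → T (x ≼ᵇ y) → T (y ≼ᵇ z) → T (x ≼ᵇ z)
  ≼ᵇ-trans {x} {y} {z} x≼y y≼z =
    Equivalence.from (T-≼ᵇ⇔ x z) (≼-trans (Equivalence.to (T-≼ᵇ⇔ x y) x≼y) (Equivalence.to (T-≼ᵇ⇔ y z) y≼z))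

  δ-nonneg⇔ : ∀ {r s} (α : Fin r → ℚ) (β : Fin s → ℚ) x b →
    + 0 ℤ.≤ δ α β x b ⇔ count (λ j → (ℕtoℚ b * β j) ≼ᵇ x) ℕ.≤ count (λ i → (ℕtoℚ b * α i) ≼ᵇ x)
  δ-nonneg⇔ α β x b = mk⇔ (ℤ.drop‿+≤+ ∘ ℤ.0≤i-j⇒j≤i) (ℤ.i≤j⇒0≤j-i ∘ ℤ.+≤+)

  module ≼-Below = CountBelow _≼ᵇ_ ≼ᵇ-total (λ {x} {y} {z} → ≼ᵇ-trans {x} {y} {z})

  module ≤-Below = CountBelow lessEqᵇ lessEqᵇ-total (λ {x} {y} {z} → lessEqᵇ-trans {x} {y} {z})

  δ-nonneg⇔at-bβ : ∀ {r s} (α : Fin r → ℚ) (β : Fin s → ℚ) b →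
    (∀ x → + 0 ℤ.≤ δ α β x b) ⇔ (∀ k → + 0 ℤ.≤ δ α β (ℕtoℚ b * β k) b)
  δ-nonneg⇔at-bβ α β b = mk⇔ (λ everywhere k → everywhere (ℕtoℚ b * β k))
    (λ at-bβ x → Equivalence.from (δ-nonneg⇔ α β x b)
      (≼-Below.countBelow-≤-everywhere (λ i → ℕtoℚ b * α i) (λ j → ℕtoℚ b * β j)
        (λ k → Equivalence.to (δ-nonneg⇔ α β _ b) (at-bβ k)) x))

  -- p-integrality and the Dwork digit

  prime^∣-*-coprime : ∀ {p} → Prime p → ∀ l {x} y → ¬ p ∣ x → p ^ l ∣ x ℕ.* y → p ^ l ∣ y
  prime^∣-*-coprime pp zero y p∤x _ = ℕ.1∣ y
  prime^∣-*-coprime {p} pp (suc l) {x} y p∤x p^l+1∣xy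
    with euclidsLemma x y pp (ℕ.∣-trans (ℕ.m∣m*n (p ^ l)) p^l+1∣xy)
  ... | inj₁ p∣x = ⊥-elim (p∤x p∣x)
  ... | inj₂ (divides y′ refl) =
    subst (_∣ y′ ℕ.* p) (ℕ.*-comm (p ^ l) p) (ℕ.*-monoˡ-∣ p (prime^∣-*-coprime pp l y′ p∤x p^l∣xy′))
    where
    instance _ = prime⇒nonZero pp
    p^l∣xy′ : p ^ l ∣ x ℕ.* y′
    p^l∣xy′ = ℕ.*-cancelˡ-∣ p (subst (p ℕ.* p ^ l ∣_)
      (trans (sym (ℕ.*-assoc x y′ p)) (ℕ.*-comm (x ℕ.* y′) p)) p^l+1∣xy)

  IsPIntegral : ℕ → ℚ → Set
  IsPIntegral p q = ∃ λ k → ¬ p ∣ k × IsInteger (ℕtoℚ k * q)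

  T-pIntegralᵇ⇔ : ∀ p q → T (pIntegralᵇ p q) ⇔ IsPIntegral p q
  T-pIntegralᵇ⇔ p q = mk⇔
    (λ t → ↧ₙ q , toWitness t , denominator∣⇒isInteger (↧ₙ q) q ℕ.∣-refl)
    (λ (k , p∤k , kq∈ℤ) → fromWitness (λ p∣den → p∤k (ℕ.∣-trans p∣den (isInteger⇒denominator∣ k q kq∈ℤ))))

  isPIntegral-- : ∀ {p x y} → Prime p → IsPIntegral p x → IsPIntegral p y → IsPIntegral p (x - y)
  isPIntegral-- {p} {x} {y} pp (k , p∤k , kx∈ℤ) (m , p∤m , my∈ℤ) =
    k ℕ.* m , [ p∤k , p∤m ]′ ∘ (λ p∣km → euclidsLemma k m pp p∣km) ,
    subst IsInteger (sym eq) (isInteger-- (isInteger-* (ℕtoℚ-isInteger m) kx∈ℤ) (isInteger-* (ℕtoℚ-isInteger k) my∈ℤ))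
    where
    eq : ℕtoℚ (k ℕ.* m) * (x - y) ≡ ℕtoℚ m * (ℕtoℚ k * x) - ℕtoℚ k * (ℕtoℚ m * y)
    eq = trans (cong (_* (x - y)) (ℕtoℚ-* k m))
      (solve 4 (λ k m x y → k :* m :* (x :- y) := m :* (k :* x) :- k :* (m :* y)) refl (ℕtoℚ k) (ℕtoℚ m) x y)

  isPIntegral-n*invPow⇒p^l∣n : ∀ {p} .{{_ : NonZero p}} → Prime p → ∀ l n →
                          IsPIntegral p (ℕtoℚ n * invPow p l) → p ^ l ∣ n
  isPIntegral-n*invPow⇒p^l∣n {p} pp l n (k , p∤k , (z , kn/P≡z)) =
    prime^∣-*-coprime pp l n p∤k (divides ℤ.∣ z ∣ (trans (cong ℤ.∣_∣ kn≡zP) (ℤ.abs-* z (+ p ^ l))))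
    where
    instance _ = ℕ.m^n≢0 p l
    kn≡zP : + (k ℕ.* n) ≡ z ℤ.* + p ^ l
    kn≡zP = ι-injective (begin
      ℕtoℚ (k ℕ.* n)                                 ≡⟨ ℕtoℚ-* k n ⟩
      ℕtoℚ k * ℕtoℚ n                                ≡⟨ ℚ.*-identityʳ _ ⟨
      ℕtoℚ k * ℕtoℚ n * 1ℚ                           ≡⟨ cong (ℕtoℚ k * ℕtoℚ n *_) (ℕtoℚ-*-inverse (p ^ l)) ⟨
      ℕtoℚ k * ℕtoℚ n * (ℕtoℚ (p ^ l) * invPow p l)  ≡⟨ solve 4 (λ k n P i → k :* n :* (P :* i) := k :* (n :* i) :* P)
                                                          refl (ℕtoℚ k) (ℕtoℚ n) (ℕtoℚ (p ^ l)) (invPow p l) ⟩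
      ℕtoℚ k * (ℕtoℚ n * invPow p l) * ℕtoℚ (p ^ l)  ≡⟨ cong (_* ℕtoℚ (p ^ l)) kn/P≡z ⟩
      ι z * ℕtoℚ (p ^ l)                             ≡⟨ ι-* z (+ p ^ l) ⟨
      ι (z ℤ.* + p ^ l)                              ∎)
      where open ≡-Reasoning

  firstFrom-≡ : ∀ (f : ℕ → Bool) fuel k m → k ℕ.≤ m → m ℕ.< k ℕ.+ fuel → T (f m) →
                (∀ j → k ℕ.≤ j → j ℕ.< m → ¬ T (f j)) → firstFrom f fuel k ≡ m
  firstFrom-≡ f zero k m k≤m m<k+0 _ _ =
    ⊥-elim (ℕ.<-irrefl refl (ℕ.<-≤-trans (subst (m ℕ.<_) (ℕ.+-identityʳ k) m<k+0) k≤m))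
  firstFrom-≡ f (suc fuel) k m k≤m m<k+fuel fm none-below with f k in fk | ℕ.m≤n⇒m<n∨m≡n k≤m
  ... | true  | inj₂ refl = refl
  ... | true  | inj₁ k<m  = ⊥-elim (none-below k ℕ.≤-refl k<m (subst T (sym fk) _))
  ... | false | inj₂ refl = ⊥-elim (subst T fk fm)
  ... | false | inj₁ k<m  = firstFrom-≡ f fuel (suc k) m k<m (subst (m ℕ.<_) (ℕ.+-suc k fuel) m<k+fuel) fm
                              (λ j k<j j<m → none-below j (ℕ.<⇒≤ k<j) j<m)

  dworkDigit-unique : ∀ {p} .{{_ : NonZero p}} → Prime p → ∀ l γ m → m ℕ.< p ^ l →
                      IsPIntegral p ((γ + ℕtoℚ m) * invPow p l) → dworkDigit p l γ ≡ m
  dworkDigit-unique {p} pp l γ m m<P integral-at-m =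
    firstFrom-≡ isPIntegralAt (p ^ l) 0 m z≤n m<P (Equivalence.from (T-pIntegralᵇ⇔ p _) integral-at-m) none-below
    where
    inv = invPow p l
    isPIntegralAt : ℕ → Bool
    isPIntegralAt k = pIntegralᵇ p ((γ + ℕtoℚ k) * inv)
    none-below : ∀ j → 0 ℕ.≤ j → j ℕ.< m → ¬ T (isPIntegralAt j)
    none-below j _ j<m integral-at-j = ℕ.<-irrefl refl (ℕ.<-≤-trans m<P (ℕ.≤-trans P≤m∸j (ℕ.m∸n≤m m j)))
      where
      gap : (γ + ℕtoℚ m) * inv - (γ + ℕtoℚ j) * inv ≡ ℕtoℚ (m ∸ j) * inv
      gap = begin
        (γ + ℕtoℚ m) * inv - (γ + ℕtoℚ j) * inv                 ≡⟨ cong (λ w → (γ + ℕtoℚ w) * inv - (γ + ℕtoℚ j) * inv)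
                                                                      (ℕ.m+[n∸m]≡n (ℕ.<⇒≤ j<m)) ⟨
        (γ + ℕtoℚ (j ℕ.+ (m ∸ j))) * inv - (γ + ℕtoℚ j) * inv   ≡⟨ cong (λ w → (γ + w) * inv - (γ + ℕtoℚ j) * inv)
                                                                      (ℕtoℚ-+ j (m ∸ j)) ⟩
        (γ + (ℕtoℚ j + ℕtoℚ (m ∸ j))) * inv - (γ + ℕtoℚ j) * inv ≡⟨ solve 4 (λ g j d i → (g :+ (j :+ d)) :* i :- (g :+ j) :* i := d :* i)
                                                                      refl γ (ℕtoℚ j) (ℕtoℚ (m ∸ j)) inv ⟩
        ℕtoℚ (m ∸ j) * inv                                      ∎
        where open ≡-Reasoning
      P≤m∸j : p ^ l ℕ.≤ m ∸ j
      P≤m∸j = ℕ.∣⇒≤ {{ℕ.>-nonZero (ℕ.m<n⇒0<n∸m j<m)}} (isPIntegral-n*invPow⇒p^l∣n pp l (m ∸ j) (subst (IsPIntegral p) gap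
        (isPIntegral-- pp integral-at-m (Equivalence.to (T-pIntegralᵇ⇔ p _) integral-at-j))))

  module _ (p : ℕ) .{{_ : NonZero p}} (l : ℕ) where

    private
      instance _ = ℕ.m^n≢0 p l

    p^l*invPow≡1 : ℕtoℚ (p ^ l) * invPow p l ≡ 1ℚ
    p^l*invPow≡1 = ℕtoℚ-*-inverse (p ^ l)

    0<invPow : 0ℚ < invPow p l
    0<invPow = ℚ.positive⁻¹ (invPow p l) {{ℚ.normalize-pos 1 (p ^ l)}}

    *invPow-mono-≤ : ∀ {x y} → x ≤ y → x * invPow p l ≤ y * invPow p l
    *invPow-mono-≤ = ℚ.*-monoʳ-≤-nonNeg (invPow p l) {{ℚ.nonNegative (ℚ.<⇒≤ 0<invPow)}}

    *invPow-mono-< : ∀ {x y} → x < y → x * invPow p l < y * invPow p l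
    *invPow-mono-< = ℚ.*-monoˡ-<-pos (invPow p l) {{ℚ.positive 0<invPow}}

    *invPow-cancel-≤ : ∀ {x y} → x * invPow p l ≤ y * invPow p l → x ≤ y
    *invPow-cancel-≤ = ℚ.*-cancelʳ-≤-pos (invPow p l) {{ℚ.positive 0<invPow}}

    T-lessEqᵇ-*invPow⇔≤ : ∀ {x} m k → x ≡ ℕtoℚ m * invPow p l → T (lessEqᵇ x (ℕtoℚ k * invPow p l)) ⇔ m ℕ.≤ k
    T-lessEqᵇ-*invPow⇔≤ m k refl = mk⇔
      (ℤ.drop‿+≤+ ∘ ι-cancel-≤ {+ m} {+ k} ∘ *invPow-cancel-≤ ∘ Equivalence.to (T-lessEqᵇ⇔ _ _))
      (fromWitness ∘ *invPow-mono-≤ ∘ ι-mono-≤ {+ m} {+ k} ∘ ℤ.+≤+)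

    ceiling-[n-m]*invPow≡1 : ∀ {m n} → m ℕ.< n → n ℕ.≤ p ^ l → ceiling ((ℕtoℚ n - ℕtoℚ m) * invPow p l) ≡ + 1
    ceiling-[n-m]*invPow≡1 {m} {n} m<n n≤P = ceiling-unique ((ℕtoℚ n - ℕtoℚ m) * invPow p l) (+ 1)
      (subst₂ _<_ (trans (ℚ.*-zeroˡ (invPow p l)) (sym (ℚ.+-inverseʳ 1ℚ))) refl
        (*invPow-mono-< (p<q⇒0<q-p (ι-mono-< {+ m} {+ n} (ℤ.+<+ m<n)))))
      (subst ((ℕtoℚ n - ℕtoℚ m) * invPow p l ≤_) p^l*invPow≡1 (*invPow-mono-≤ (begin
        ℕtoℚ n - ℕtoℚ m  ≤⟨ 0≤q-p⇒p≤q {ℕtoℚ n - ℕtoℚ m}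
                              (subst (0ℚ ≤_) (solve 2 (λ n m → m := n :- (n :- m)) refl (ℕtoℚ n) (ℕtoℚ m)) (0≤ℕtoℚ m)) ⟩
        ℕtoℚ n           ≤⟨ ι-mono-≤ {+ n} {+ p ^ l} (ℤ.+≤+ n≤P) ⟩
        ℕtoℚ (p ^ l)     ∎)))
      where open ℚ.≤-Reasoning

    ceiling-[n-m]*invPow≡0 : ∀ {m n} → m ℕ.< p ^ l → n ℕ.≤ m → ceiling ((ℕtoℚ n - ℕtoℚ m) * invPow p l) ≡ + 0
    ceiling-[n-m]*invPow≡0 {m} {n} m<P n≤m = ceiling-unique ((ℕtoℚ n - ℕtoℚ m) * invPow p l) (+ 0)
      (0<q-p⇒p<q {ι (+ 0) - 1ℚ} (subst (0ℚ <_) [P-m+n]/P≡[n-m]/P+1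
        (subst₂ _<_ (ℚ.*-zeroˡ (invPow p l)) refl (*invPow-mono-< 0<P-m+n))))
      (subst₂ _≤_ refl (ℚ.*-zeroˡ (invPow p l)) (*invPow-mono-≤ (0≤q-p⇒p≤q {ℕtoℚ n - ℕtoℚ m} {0ℚ}
        (subst (0ℚ ≤_) (solve 2 (λ n m → m :- n := con 0ℚ :- (n :- m)) refl (ℕtoℚ n) (ℕtoℚ m))
          (p≤q⇒0≤q-p (ι-mono-≤ {+ n} {+ m} (ℤ.+≤+ n≤m)))))))
      where
      P = ℕtoℚ (p ^ l)
      0<P-m+n : 0ℚ < P - ℕtoℚ m + ℕtoℚ n
      0<P-m+n = ℚ.<-≤-trans (p<q⇒0<q-p (ι-mono-< {+ m} {+ p ^ l} (ℤ.+<+ m<P)))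
        (subst (_≤ P - ℕtoℚ m + ℕtoℚ n) (ℚ.+-identityʳ (P - ℕtoℚ m)) (ℚ.+-monoʳ-≤ (P - ℕtoℚ m) (0≤ℕtoℚ n)))
      [P-m+n]/P≡[n-m]/P+1 : (P - ℕtoℚ m + ℕtoℚ n) * invPow p l ≡ (ℕtoℚ n - ℕtoℚ m) * invPow p l - (ι (+ 0) - 1ℚ)
      [P-m+n]/P≡[n-m]/P+1 = trans
        (solve 4 (λ P m n i → (P :- m :+ n) :* i := (n :- m) :* i :- (con 0ℚ :- P :* i)) refl P (ℕtoℚ m) (ℕtoℚ n) (invPow p l))
        (cong (λ w → (ℕtoℚ n - ℕtoℚ m) * invPow p l - (0ℚ - w)) p^l*invPow≡1)

  dworkExcess : (p : ℕ) .{{_ : NonZero p}} → ℕ → ℚ → ℚ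
  dworkExcess p l γ = dwork p l γ - γ * invPow p l

  module _ (p : ℕ) .{{_ : NonZero p}} (l : ℕ) (γ : ℚ) where

    dworkExcess≡digit*invPow : dworkExcess p l γ ≡ ℕtoℚ (dworkDigit p l γ) * invPow p l
    dworkExcess≡digit*invPow = solve 3 (λ g m i → (g :+ m) :* i :- g :* i := m :* i) refl γ (ℕtoℚ (dworkDigit p l γ)) (invPow p l)

    dwork-shifted : ∀ n → (ℕtoℚ n + γ) * invPow p l - dwork p l γ ≡ (ℕtoℚ n - ℕtoℚ (dworkDigit p l γ)) * invPow p l
    dwork-shifted n = solve 4 (λ n g m i → (n :+ g) :* i :- (g :+ m) :* i := (n :- m) :* i) refl
      (ℕtoℚ n) γ (ℕtoℚ (dworkDigit p l γ)) (invPow p l)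

  dwork-ceiling-indicator : ∀ p .{{_ : NonZero p}} l γ n → dworkDigit p l γ ℕ.< p ^ l → 1 ℕ.≤ n → n ℕ.≤ p ^ l →
    let c = ceiling ((ℕtoℚ n + γ) * invPow p l - dwork p l γ)
        below = T (lessEqᵇ (dworkExcess p l γ) (ℕtoℚ (n ∸ 1) * invPow p l))
    in (below → c ≡ + 1) × (¬ below → c ≡ + 0)
  dwork-ceiling-indicator p l γ n m<P 1≤n n≤P =
    (λ below → trans (cong ceiling (dwork-shifted p l γ n))
       (ceiling-[n-m]*invPow≡1 p l (m≤n∸1⇒m<n (Equivalence.to (T-below⇔ (n ∸ 1)) below)) n≤P)) ,
    (λ not-below → trans (cong ceiling (dwork-shifted p l γ n))
       (ceiling-[n-m]*invPow≡0 p l m<P (m≰n∸1⇒n≤m (not-below ∘ Equivalence.from (T-below⇔ (n ∸ 1))))))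
    where
    m = dworkDigit p l γ
    T-below⇔ : ∀ k → T (lessEqᵇ (dworkExcess p l γ) (ℕtoℚ k * invPow p l)) ⇔ m ℕ.≤ k
    T-below⇔ k = T-lessEqᵇ-*invPow⇔≤ p l m k (dworkExcess≡digit*invPow p l γ)
    m≤n∸1⇒m<n : m ℕ.≤ n ∸ 1 → m ℕ.< n
    m≤n∸1⇒m<n m≤n∸1 = ℕ.<-≤-trans (s≤s m≤n∸1) (ℕ.≤-reflexive (ℕ.suc-pred n {{ℕ.>-nonZero 1≤n}}))
    m≰n∸1⇒n≤m : ¬ m ℕ.≤ n ∸ 1 → n ℕ.≤ m
    m≰n∸1⇒n≤m m≰n∸1 = subst (ℕ._≤ m) (ℕ.suc-pred n {{ℕ.>-nonZero 1≤n}}) (ℕ.≰⇒> m≰n∸1)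

  -- The Dwork digit of an admissible parameter

  module DigitFormula (p : ℕ) .{{_ : NonZero p}} (pp : Prime p) (l b d t : ℕ)
    (bP≡1+td : b ℕ.* p ^ l ≡ 1 ℕ.+ t ℕ.* d) (p∤d : ¬ p ∣ d) where

    P : ℕ
    P = p ^ l

    digitFormula : ℚ → ℚ
    digitFormula γ = ℕtoℚ P * ⟨ ℕtoℚ b * γ ⟩ - γ

    1≤d : 1 ℕ.≤ d
    1≤d = ℕ.n≢0⇒n>0 (λ d≡0 → p∤d (subst (p ∣_) (sym d≡0) (p ℕ.∣0)))

    1≤b : 1 ℕ.≤ b
    1≤b = ℕ.n≢0⇒n>0 (λ { refl → ℕ.0≢1+n bP≡1+td })

    bP≡1+tdℚ : ℕtoℚ b * ℕtoℚ P ≡ 1ℚ + ℕtoℚ t * ℕtoℚ d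
    bP≡1+tdℚ = begin
      ℕtoℚ b * ℕtoℚ P          ≡⟨ ℕtoℚ-* b P ⟨
      ℕtoℚ (b ℕ.* P)           ≡⟨ cong ℕtoℚ bP≡1+td ⟩
      ℕtoℚ (1 ℕ.+ t ℕ.* d)     ≡⟨ trans (ℕtoℚ-+ 1 (t ℕ.* d)) (cong (λ w → 1ℚ + w) (ℕtoℚ-* t d)) ⟩
      1ℚ + ℕtoℚ t * ℕtoℚ d     ∎
      where open ≡-Reasoning

    module _ {γ : ℚ} (dγ∈ℤ : IsInteger (ℕtoℚ d * γ)) where

      private
        F = ⟨ ℕtoℚ b * γ ⟩

      d⟨bγ⟩∈ℤ : IsInteger (ℕtoℚ d * ⟨ ℕtoℚ b * γ ⟩)
      d⟨bγ⟩∈ℤ = subst IsInteger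
        (solve 4 (λ d b g F → b :* (d :* g) :- d :* (b :* g :- F) := d :* F) refl (ℕtoℚ d) (ℕtoℚ b) γ F)
        (isInteger-- (isInteger-* (ℕtoℚ-isInteger b) dγ∈ℤ) (isInteger-* (ℕtoℚ-isInteger d) (x-⟨x⟩-isInteger (ℕtoℚ b * γ))))

      0<d⟨bγ⟩ : 0ℚ < ℕtoℚ d * ⟨ ℕtoℚ b * γ ⟩
      0<d⟨bγ⟩ = 0<* (0<ℕtoℚ 1≤d) (⟨⟩-pos (ℕtoℚ b * γ))

      digitFormula∈ℤ : IsInteger (digitFormula γ)
      digitFormula∈ℤ = subst IsInteger eq
        (isInteger-- (isInteger-* (ℕtoℚ-isInteger t) dγ∈ℤ) (isInteger-* (ℕtoℚ-isInteger P) (x-⟨x⟩-isInteger (ℕtoℚ b * γ))))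
        where
        eq : ℕtoℚ t * (ℕtoℚ d * γ) - ℕtoℚ P * (ℕtoℚ b * γ - F) ≡ digitFormula γ
        eq = begin
          ℕtoℚ t * (ℕtoℚ d * γ) - ℕtoℚ P * (ℕtoℚ b * γ - F)
            ≡⟨ solve 6 (λ t d g P b F → t :* (d :* g) :- P :* (b :* g :- F) := (con 1ℚ :+ t :* d) :* g :- b :* P :* g :+ (P :* F :- g))
                 refl (ℕtoℚ t) (ℕtoℚ d) γ (ℕtoℚ P) (ℕtoℚ b) F ⟩
          (1ℚ + ℕtoℚ t * ℕtoℚ d) * γ - ℕtoℚ b * ℕtoℚ P * γ + digitFormula γ
            ≡⟨ cong (λ w → (1ℚ + ℕtoℚ t * ℕtoℚ d) * γ - w * γ + digitFormula γ) bP≡1+tdℚ ⟩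
          (1ℚ + ℕtoℚ t * ℕtoℚ d) * γ - (1ℚ + ℕtoℚ t * ℕtoℚ d) * γ + digitFormula γ
            ≡⟨ solve 2 (λ x y → x :- x :+ y := y) refl ((1ℚ + ℕtoℚ t * ℕtoℚ d) * γ) (digitFormula γ) ⟩
          digitFormula γ ∎
          where open ≡-Reasoning

      digitFormula-pos : ℕtoℚ d * γ < ℕtoℚ P → 0ℚ < digitFormula γ
      digitFormula-pos dγ<P = p<q⇒0<q-p (d*v<P⇒v<P*u d P d⟨bγ⟩∈ℤ 0<d⟨bγ⟩ dγ<P)

      digitFormula-<P : NotNonPosInt γ → - (ℕtoℚ d * γ) < ℕtoℚ P → digitFormula γ < ℕtoℚ P
      digitFormula-<P γ∉ℤ≤0 -dγ<P = by-cases (ℚ.<-cmp F 1ℚ)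
        where
        by-cases : Tri (F < 1ℚ) (F ≡ 1ℚ) (1ℚ < F) → digitFormula γ < ℕtoℚ P
        by-cases (tri< F<1 _ _) = 0<q-p⇒p<q (subst (0ℚ <_) eq (p<q⇒0<q-p (d*v<P⇒v<P*u d P d[1-F]∈ℤ 0<d[1-F] d[-γ]<P)))
          where
          d[1-F]∈ℤ : IsInteger (ℕtoℚ d * (1ℚ - F))
          d[1-F]∈ℤ = subst IsInteger (solve 2 (λ d F → d :- d :* F := d :* (con 1ℚ :- F)) refl (ℕtoℚ d) F)
            (isInteger-- (ℕtoℚ-isInteger d) d⟨bγ⟩∈ℤ)
          0<d[1-F] : 0ℚ < ℕtoℚ d * (1ℚ - F)
          0<d[1-F] = 0<* (0<ℕtoℚ 1≤d) (p<q⇒0<q-p F<1)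
          d[-γ]<P : ℕtoℚ d * (- γ) < ℕtoℚ P
          d[-γ]<P = subst (_< ℕtoℚ P) (solve 2 (λ d g → :- (d :* g) := d :* (:- g)) refl (ℕtoℚ d) γ) -dγ<P
          eq : ℕtoℚ P * (1ℚ - F) - - γ ≡ ℕtoℚ P - digitFormula γ
          eq = solve 3 (λ P F g → P :* (con 1ℚ :- F) :- :- g := P :- (P :* F :- g)) refl (ℕtoℚ P) F γ
        by-cases (tri≈ _ F≡1 _) = 0<q-p⇒p<q (subst (0ℚ <_) γ≡P-digitFormula (notNonPosInt-isInteger⇒pos γ∉ℤ≤0 γ∈ℤ))
          where
          γ≡P-digitFormula : γ ≡ ℕtoℚ P - digitFormula γ
          γ≡P-digitFormula = trans (solve 2 (λ P g → g := P :- (P :* con 1ℚ :- g)) refl (ℕtoℚ P) γ)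
                                   (cong (λ w → ℕtoℚ P - (ℕtoℚ P * w - γ)) (sym F≡1))
          γ∈ℤ : IsInteger γ
          γ∈ℤ = subst IsInteger (sym γ≡P-digitFormula) (isInteger-- (ℕtoℚ-isInteger P) digitFormula∈ℤ)
        by-cases (tri> _ _ 1<F) = ⊥-elim (ℚ.<-irrefl refl (ℚ.<-≤-trans 1<F (⟨⟩-≤1 (ℕtoℚ b * γ))))

      dworkDigit≡digitFormula : NotNonPosInt γ → ℕtoℚ d * γ < ℕtoℚ P → - (ℕtoℚ d * γ) < ℕtoℚ P →
        ℕtoℚ (dworkDigit p l γ) ≡ digitFormula γ × 1 ℕ.≤ dworkDigit p l γ × dworkDigit p l γ ℕ.< P
      dworkDigit≡digitFormula γ∉ℤ≤0 dγ<P -dγ<P =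
        digit-is-m (isInteger-between⇒ℕ P digitFormula∈ℤ (digitFormula-pos dγ<P) (digitFormula-<P γ∉ℤ≤0 -dγ<P))
        where
        digit-is-m : (∃ λ m → digitFormula γ ≡ ℕtoℚ m × 1 ℕ.≤ m × m ℕ.< P) →
          ℕtoℚ (dworkDigit p l γ) ≡ digitFormula γ × 1 ℕ.≤ dworkDigit p l γ × dworkDigit p l γ ℕ.< P
        digit-is-m (m , digitFormula≡m , 1≤m , m<P) =
          trans (cong ℕtoℚ digit≡m) (sym digitFormula≡m) ,
          subst (1 ℕ.≤_) (sym digit≡m) 1≤m ,
          subst (ℕ._< P) (sym digit≡m) m<P
          where
          [γ+m]/P≡F : (γ + ℕtoℚ m) * invPow p l ≡ F
          [γ+m]/P≡F = begin
            (γ + ℕtoℚ m) * invPow p l             ≡⟨ cong (λ w → (γ + w) * invPow p l) digitFormula≡m ⟨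
            (γ + (ℕtoℚ P * F - γ)) * invPow p l   ≡⟨ solve 4 (λ g P F i → (g :+ (P :* F :- g)) :* i := F :* (P :* i))
                                                       refl γ (ℕtoℚ P) F (invPow p l) ⟩
            F * (ℕtoℚ P * invPow p l)             ≡⟨ cong (F *_) (p^l*invPow≡1 p l) ⟩
            F * 1ℚ                                ≡⟨ ℚ.*-identityʳ F ⟩
            F                                     ∎
            where open ≡-Reasoning
          digit≡m : dworkDigit p l γ ≡ m
          digit≡m = dworkDigit-unique pp l γ m m<P (d , p∤d , subst (λ w → IsInteger (ℕtoℚ d * w)) (sym [γ+m]/P≡F) d⟨bγ⟩∈ℤ)

    module _ {γ₁ γ₂ : ℚ} (dγ₁∈ℤ : IsInteger (ℕtoℚ d * γ₁)) (dγ₂∈ℤ : IsInteger (ℕtoℚ d * γ₂)) where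

      private
        F₁ = ⟨ ℕtoℚ b * γ₁ ⟩
        F₂ = ⟨ ℕtoℚ b * γ₂ ⟩

      digitFormula-<-mono : ℕtoℚ d * γ₂ - ℕtoℚ d * γ₁ < ℕtoℚ P → ⟨ ℕtoℚ b * γ₁ ⟩ < ⟨ ℕtoℚ b * γ₂ ⟩ →
                            digitFormula γ₁ < digitFormula γ₂
      digitFormula-<-mono dγ₂-dγ₁<P F₁<F₂ =
        0<q-p⇒p<q (subst (0ℚ <_) eq (p<q⇒0<q-p (d*v<P⇒v<P*u d P d[F₂-F₁]∈ℤ 0<d[F₂-F₁] d[γ₂-γ₁]<P)))
        where
        d[F₂-F₁]∈ℤ : IsInteger (ℕtoℚ d * (F₂ - F₁))
        d[F₂-F₁]∈ℤ = subst IsInteger (solve 3 (λ d x y → d :* y :- d :* x := d :* (y :- x)) refl (ℕtoℚ d) F₁ F₂)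
          (isInteger-- (d⟨bγ⟩∈ℤ dγ₂∈ℤ) (d⟨bγ⟩∈ℤ dγ₁∈ℤ))
        0<d[F₂-F₁] : 0ℚ < ℕtoℚ d * (F₂ - F₁)
        0<d[F₂-F₁] = 0<* (0<ℕtoℚ 1≤d) (p<q⇒0<q-p F₁<F₂)
        d[γ₂-γ₁]<P : ℕtoℚ d * (γ₂ - γ₁) < ℕtoℚ P
        d[γ₂-γ₁]<P = subst (_< ℕtoℚ P) (solve 3 (λ d x y → d :* y :- d :* x := d :* (y :- x)) refl (ℕtoℚ d) γ₁ γ₂) dγ₂-dγ₁<P
        eq : ℕtoℚ P * (F₂ - F₁) - (γ₂ - γ₁) ≡ digitFormula γ₂ - digitFormula γ₁
        eq = solve 5 (λ P F₁ F₂ g₁ g₂ → P :* (F₂ :- F₁) :- (g₂ :- g₁) := (P :* F₂ :- g₂) :- (P :* F₁ :- g₁))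
          refl (ℕtoℚ P) F₁ F₂ γ₁ γ₂

      digitFormula-gap : ⟨ ℕtoℚ b * γ₁ ⟩ ≡ ⟨ ℕtoℚ b * γ₂ ⟩ → digitFormula γ₂ - digitFormula γ₁ ≡ γ₁ - γ₂
      digitFormula-gap F₁≡F₂ = trans (cong (λ w → (ℕtoℚ P * w - γ₂) - digitFormula γ₁) (sym F₁≡F₂))
        (solve 4 (λ P F g₁ g₂ → (P :* F :- g₂) :- (P :* F :- g₁) := g₁ :- g₂) refl (ℕtoℚ P) F₁ γ₁ γ₂)

    digitFormula-≤⇔≼ : ∀ {γ₁ γ₂} → IsInteger (ℕtoℚ d * γ₁) → IsInteger (ℕtoℚ d * γ₂) →
      ℕtoℚ d * γ₂ - ℕtoℚ d * γ₁ < ℕtoℚ P → ℕtoℚ d * γ₁ - ℕtoℚ d * γ₂ < ℕtoℚ P →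
      digitFormula γ₁ ≤ digitFormula γ₂ ⇔ (ℕtoℚ b * γ₁) ≼ (ℕtoℚ b * γ₂)
    digitFormula-≤⇔≼ {γ₁} {γ₂} dγ₁∈ℤ dγ₂∈ℤ dγ₂-dγ₁<P dγ₁-dγ₂<P = mk⇔ to from
      where
      to : digitFormula γ₁ ≤ digitFormula γ₂ → (ℕtoℚ b * γ₁) ≼ (ℕtoℚ b * γ₂)
      to df₁≤df₂ = by-cases (ℚ.<-cmp ⟨ ℕtoℚ b * γ₁ ⟩ ⟨ ℕtoℚ b * γ₂ ⟩)
        where
        by-cases : Tri (⟨ ℕtoℚ b * γ₁ ⟩ < ⟨ ℕtoℚ b * γ₂ ⟩) (⟨ ℕtoℚ b * γ₁ ⟩ ≡ ⟨ ℕtoℚ b * γ₂ ⟩) (⟨ ℕtoℚ b * γ₂ ⟩ < ⟨ ℕtoℚ b * γ₁ ⟩) →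
                   (ℕtoℚ b * γ₁) ≼ (ℕtoℚ b * γ₂)
        by-cases (tri< F₁<F₂ _ _) = inj₁ F₁<F₂
        by-cases (tri≈ _ F₁≡F₂ _) = inj₂ (F₁≡F₂ , ℚ.*-monoˡ-≤-nonNeg (ℕtoℚ b) {{ℚ.nonNegative (0≤ℕtoℚ b)}}
          (0≤q-p⇒p≤q (subst (0ℚ ≤_) (digitFormula-gap dγ₁∈ℤ dγ₂∈ℤ F₁≡F₂) (p≤q⇒0≤q-p df₁≤df₂))))
        by-cases (tri> _ _ F₂<F₁) = ⊥-elim (ℚ.<-irrefl refl
          (ℚ.<-≤-trans (digitFormula-<-mono dγ₂∈ℤ dγ₁∈ℤ dγ₁-dγ₂<P F₂<F₁) df₁≤df₂))
      from : (ℕtoℚ b * γ₁) ≼ (ℕtoℚ b * γ₂) → digitFormula γ₁ ≤ digitFormula γ₂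
      from (inj₁ F₁<F₂) = ℚ.<⇒≤ (digitFormula-<-mono dγ₁∈ℤ dγ₂∈ℤ dγ₂-dγ₁<P F₁<F₂)
      from (inj₂ (F₁≡F₂ , bγ₂≤bγ₁)) = 0≤q-p⇒p≤q (subst (0ℚ ≤_) (sym (digitFormula-gap dγ₁∈ℤ dγ₂∈ℤ F₁≡F₂))
        (p≤q⇒0≤q-p (ℚ.*-cancelˡ-≤-pos (ℕtoℚ b) {{ℚ.positive (0<ℕtoℚ 1≤b)}} bγ₂≤bγ₁)))

  Admissible : ℕ → ℚ → ℚ → Set
  Admissible d K γ = IsInteger (ℕtoℚ d * γ) × NotNonPosInt γ × ℚ.∣ ℕtoℚ d * γ ∣ ≤ K

  module Equivalences {r s : ℕ} (α : Fin r → ℚ) (β : Fin s → ℚ)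
    (p : ℕ) .{{_ : NonZero p}} (pp : Prime p) (l b d t : ℕ)
    (bP≡1+td : b ℕ.* p ^ l ≡ 1 ℕ.+ t ℕ.* d) (p∤d : ¬ p ∣ d)
    (K : ℚ) (K+K<P : K + K < ℕtoℚ (p ^ l))
    (α-admissible : ∀ i → Admissible d K (α i)) (β-admissible : ∀ j → Admissible d K (β j)) where

    open DigitFormula p pp l b d t bP≡1+td p∤d

    private
      inv = invPow p l
      e = dworkExcess p l

    K<P : ∀ {γ} → Admissible d K γ → K < ℕtoℚ P
    K<P {γ} (_ , _ , ∣dγ∣≤K) = ℚ.≤-<-trans (subst (_≤ K + K) (ℚ.+-identityˡ K) (ℚ.+-monoˡ-≤ K 0≤K)) K+K<P
      where 0≤K = ℚ.≤-trans (ℚ.0≤∣p∣ (ℕtoℚ d * γ)) ∣dγ∣≤K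

    dγ<P : ∀ {γ} → Admissible d K γ → ℕtoℚ d * γ < ℕtoℚ P
    dγ<P {γ} adm@(_ , _ , ∣dγ∣≤K) = ℚ.≤-<-trans (ℚ.≤-trans (p≤∣p∣ (ℕtoℚ d * γ)) ∣dγ∣≤K) (K<P adm)

    -dγ<P : ∀ {γ} → Admissible d K γ → - (ℕtoℚ d * γ) < ℕtoℚ P
    -dγ<P {γ} adm@(_ , _ , ∣dγ∣≤K) = ℚ.≤-<-trans (ℚ.≤-trans (-p≤∣p∣ (ℕtoℚ d * γ)) ∣dγ∣≤K) (K<P adm)

    dγ₂-dγ₁<P : ∀ {γ₁ γ₂} → Admissible d K γ₁ → Admissible d K γ₂ → ℕtoℚ d * γ₂ - ℕtoℚ d * γ₁ < ℕtoℚ P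
    dγ₂-dγ₁<P {γ₁} {γ₂} (_ , _ , ∣dγ₁∣≤K) (_ , _ , ∣dγ₂∣≤K) = begin-strict
      ℕtoℚ d * γ₂ - ℕtoℚ d * γ₁                 ≤⟨ p≤∣p∣ (ℕtoℚ d * γ₂ - ℕtoℚ d * γ₁) ⟩
      ℚ.∣ ℕtoℚ d * γ₂ - ℕtoℚ d * γ₁ ∣           ≤⟨ ℚ.∣p-q∣≤∣p∣+∣q∣ (ℕtoℚ d * γ₂) (ℕtoℚ d * γ₁) ⟩
      ℚ.∣ ℕtoℚ d * γ₂ ∣ + ℚ.∣ ℕtoℚ d * γ₁ ∣     ≤⟨ ℚ.+-mono-≤ ∣dγ₂∣≤K ∣dγ₁∣≤K ⟩
      K + K                                     <⟨ K+K<P ⟩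
      ℕtoℚ P                                    ∎
      where open ℚ.≤-Reasoning

    digit-facts : ∀ {γ} → Admissible d K γ → ℕtoℚ (dworkDigit p l γ) ≡ digitFormula γ × 1 ℕ.≤ dworkDigit p l γ × dworkDigit p l γ ℕ.< P
    digit-facts adm@(dγ∈ℤ , γ∉ℤ≤0 , _) = dworkDigit≡digitFormula dγ∈ℤ γ∉ℤ≤0 (dγ<P adm) (-dγ<P adm)

    dworkExcess≡digitFormula*invPow : ∀ {γ} → Admissible d K γ → e γ ≡ digitFormula γ * inv
    dworkExcess≡digitFormula*invPow {γ} adm = trans (dworkExcess≡digit*invPow p l γ) (cong (_* inv) (proj₁ (digit-facts adm)))

    dworkExcess-≤⇔≼ : ∀ {γ₁ γ₂} → Admissible d K γ₁ → Admissible d K γ₂ →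
      T (lessEqᵇ (e γ₁) (e γ₂)) ⇔ T ((ℕtoℚ b * γ₁) ≼ᵇ (ℕtoℚ b * γ₂))
    dworkExcess-≤⇔≼ {γ₁} {γ₂} adm₁@(dγ₁∈ℤ , _) adm₂@(dγ₂∈ℤ , _) =
      ⇔-trans (T-lessEqᵇ⇔ (e γ₁) (e γ₂)) (⇔-trans dworkExcess-≤⇔digitFormula-≤
        (⇔-trans (digitFormula-≤⇔≼ dγ₁∈ℤ dγ₂∈ℤ (dγ₂-dγ₁<P adm₁ adm₂) (dγ₂-dγ₁<P adm₂ adm₁)) (⇔-sym (T-≼ᵇ⇔ (ℕtoℚ b * γ₁) (ℕtoℚ b * γ₂)))))
      where
      dworkExcess-≤⇔digitFormula-≤ : e γ₁ ≤ e γ₂ ⇔ digitFormula γ₁ ≤ digitFormula γ₂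
      dworkExcess-≤⇔digitFormula-≤ = mk⇔
        (*invPow-cancel-≤ p l ∘ subst₂ _≤_ (dworkExcess≡digitFormula*invPow adm₁) (dworkExcess≡digitFormula*invPow adm₂))
        (subst₂ _≤_ (sym (dworkExcess≡digitFormula*invPow adm₁)) (sym (dworkExcess≡digitFormula*invPow adm₂)) ∘ *invPow-mono-≤ p l)

    open ≤-Below using (countBelow; countBelow-≤-everywhere)

    ii⇔iii : (∀ k → + 0 ℤ.≤ δ α β (ℕtoℚ b * β k) b) ⇔
             (∀ k → countBelow (λ j → e (β j)) (e (β k)) ℕ.≤ countBelow (λ i → e (α i)) (e (β k)))
    ii⇔iii = mk⇔
      (λ ii k → subst₂ ℕ._≤_ (sym (β-counts k)) (sym (α-counts k)) (Equivalence.to (δ-nonneg⇔ α β _ b) (ii k)))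
      (λ iii k → Equivalence.from (δ-nonneg⇔ α β _ b) (subst₂ ℕ._≤_ (β-counts k) (α-counts k) (iii k)))
      where
      β-counts : ∀ k → countBelow (λ j → e (β j)) (e (β k)) ≡ ≼-Below.countBelow (λ j → ℕtoℚ b * β j) (ℕtoℚ b * β k)
      β-counts k = count-cong (λ j → dworkExcess-≤⇔≼ (β-admissible j) (β-admissible k))
      α-counts : ∀ k → countBelow (λ i → e (α i)) (e (β k)) ≡ ≼-Below.countBelow (λ i → ℕtoℚ b * α i) (ℕtoℚ b * β k)
      α-counts k = count-cong (λ i → dworkExcess-≤⇔≼ (α-admissible i) (β-admissible k))

    private
      CountsAt : ℚ → Set
      CountsAt x = countBelow (λ j → e (β j)) x ℕ.≤ countBelow (λ i → e (α i)) x

    iii⇔iv : (∀ k → CountsAt (e (β k))) ⇔ (∀ n → 1 ℕ.≤ n → n ℕ.≤ P → CountsAt (ℕtoℚ n * inv))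
    iii⇔iv = mk⇔ to from
      where
      to : (∀ k → CountsAt (e (β k))) → ∀ n → 1 ℕ.≤ n → n ℕ.≤ P → CountsAt (ℕtoℚ n * inv)
      to iii n _ _ = countBelow-≤-everywhere (λ i → e (α i)) (λ j → e (β j)) iii (ℕtoℚ n * inv)
      from : (∀ n → 1 ℕ.≤ n → n ℕ.≤ P → CountsAt (ℕtoℚ n * inv)) → ∀ k → CountsAt (e (β k))
      from iv k = subst CountsAt (sym (dworkExcess≡digit*invPow p l (β k))) (iv (dworkDigit p l (β k)) 1≤m m≤P)
        where
        1≤m : 1 ℕ.≤ dworkDigit p l (β k)
        1≤m = proj₁ (proj₂ (digit-facts (β-admissible k)))
        m≤P : dworkDigit p l (β k) ℕ.≤ P
        m≤P = ℕ.<⇒≤ (proj₂ (proj₂ (digit-facts (β-admissible k))))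

    sumℤ-ceiling≡countBelow : ∀ {n} (v : Fin n → ℚ) → (∀ i → Admissible d K (v i)) → ∀ m → 1 ℕ.≤ m → m ℕ.≤ P →
      sumℤ (λ i → ceiling ((ℕtoℚ m + v i) * inv - dwork p l (v i))) ≡ + countBelow (λ i → e (v i)) (ℕtoℚ (m ∸ 1) * inv)
    sumℤ-ceiling≡countBelow v adm m 1≤m m≤P = sumℤ-indicator _ _
      (λ i → dwork-ceiling-indicator p l (v i) m (proj₂ (proj₂ (digit-facts (adm i)))) 1≤m m≤P)

    iii⇔v : (∀ k → CountsAt (e (β k))) ⇔
            (∀ n → 1 ℕ.≤ n → n ℕ.≤ P →
              sumℤ (λ j → ceiling ((ℕtoℚ n + β j) * inv - dwork p l (β j)))
                ℤ.≤ sumℤ (λ i → ceiling ((ℕtoℚ n + α i) * inv - dwork p l (α i))))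
    iii⇔v = mk⇔
      (λ iii n 1≤n n≤P → subst₂ ℤ._≤_ (sym (sumℤ-ceiling≡countBelow β β-admissible n 1≤n n≤P))
        (sym (sumℤ-ceiling≡countBelow α α-admissible n 1≤n n≤P))
        (ℤ.+≤+ (countBelow-≤-everywhere (λ i → e (α i)) (λ j → e (β j)) iii (ℕtoℚ (n ∸ 1) * inv))))
      (λ v k → let (_ , _ , m<P) = digit-facts (β-admissible k) in
        subst CountsAt (sym (dworkExcess≡digit*invPow p l (β k))) (ℤ.drop‿+≤+ (subst₂ ℤ._≤_
          (sumℤ-ceiling≡countBelow β β-admissible (suc (dworkDigit p l (β k))) (s≤s z≤n) m<P)
          (sumℤ-ceiling≡countBelow α α-admissible (suc (dworkDigit p l (β k))) (s≤s z≤n) m<P)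
          (v (suc (dworkDigit p l (β k))) (s≤s z≤n) m<P))))

  -- The parameters of the theorem

  lcmF-∣ : ∀ {n} (f : Fin n → ℕ) i → f i ∣ lcmF f
  lcmF-∣ f zero    = m∣lcm[m,n] (f zero) _
  lcmF-∣ f (suc i) = ℕ.∣-trans (lcmF-∣ (f ∘ suc) i) (n∣lcm[m,n] (f zero) _)

  ∣f∣≤maxAbs : ∀ {n} (f : Fin n → ℚ) i → ℚ.∣ f i ∣ ≤ maxAbs f
  ∣f∣≤maxAbs f zero    = ℚ.p≤p⊔q ℚ.∣ f zero ∣ _
  ∣f∣≤maxAbs f (suc i) = ℚ.≤-trans (∣f∣≤maxAbs (f ∘ suc) i) (ℚ.p≤q⊔p ℚ.∣ f zero ∣ _)

  admissible : ∀ {d Q γ} → ↧ₙ γ ∣ d → NotNonPosInt γ → ℚ.∣ γ ∣ ≤ Q → Admissible d (ℕtoℚ d * Q) γ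
  admissible {d} {Q} {γ} den∣d γ∉ℤ≤0 ∣γ∣≤Q =
    denominator∣⇒isInteger d γ den∣d , γ∉ℤ≤0 ,
    subst (_≤ ℕtoℚ d * Q) (sym ∣dγ∣≡d∣γ∣) (ℚ.*-monoˡ-≤-nonNeg (ℕtoℚ d) {{ℚ.nonNegative (0≤ℕtoℚ d)}} ∣γ∣≤Q)
    where
    ∣dγ∣≡d∣γ∣ : ℚ.∣ ℕtoℚ d * γ ∣ ≡ ℕtoℚ d * ℚ.∣ γ ∣
    ∣dγ∣≡d∣γ∣ = trans (ℚ.∣p*q∣≡∣p∣*∣q∣ (ℕtoℚ d) γ) (cong (_* ℚ.∣ γ ∣) (ℚ.0≤p⇒∣p∣≡p (0≤ℕtoℚ d)))

  ∣∸1⇒≡1+*d : ∀ {x d} → 1 ℕ.≤ x → d ∣ x ∸ 1 → ∃ λ t → x ≡ 1 ℕ.+ t ℕ.* d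
  ∣∸1⇒≡1+*d 1≤x (divides t x∸1≡td) = t , trans (sym (ℕ.m+[n∸m]≡n 1≤x)) (cong suc x∸1≡td)

  ≡1+*d⇒∤d : ∀ {a p t d} → Prime p → a ℕ.* p ≡ 1 ℕ.+ t ℕ.* d → ¬ p ∣ d
  ≡1+*d⇒∤d {a} {p} {t} pp ap≡1+td p∣d =
    ¬prime[1] (subst Prime (ℕ.∣1⇒≡1 (ℕ.∣m+n∣m⇒∣n p∣td+1 (ℕ.∣n⇒∣m*n t p∣d))) pp)
    where
    p∣td+1 : p ∣ t ℕ.* _ ℕ.+ 1
    p∣td+1 = subst (p ∣_) (trans ap≡1+td (ℕ.+-comm 1 _)) (ℕ.n∣m*n a)

  ^-*-≡1+*d : ∀ {x y t d} → x ℕ.* y ≡ 1 ℕ.+ t ℕ.* d → ∀ l → ∃ λ t′ → x ^ l ℕ.* y ^ l ≡ 1 ℕ.+ t′ ℕ.* d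
  ^-*-≡1+*d xy≡1+td zero = 0 , refl
  ^-*-≡1+*d {x} {y} {t} {d} xy≡1+td (suc l) with t′ , xˡyˡ≡1+t′d ← ^-*-≡1+*d {x} {y} {t} {d} xy≡1+td l =
    t′ ℕ.+ t ℕ.* u , (begin
      x ℕ.* x ^ l ℕ.* (y ℕ.* y ^ l)          ≡⟨ interchange x (x ^ l) y (y ^ l) ⟩
      x ℕ.* y ℕ.* (x ^ l ℕ.* y ^ l)          ≡⟨ cong₂ ℕ._*_ xy≡1+td xˡyˡ≡1+t′d ⟩
      (1 ℕ.+ t ℕ.* d) ℕ.* u                  ≡⟨⟩
      1 ℕ.+ (t′ ℕ.* d ℕ.+ t ℕ.* d ℕ.* u)     ≡⟨ cong (λ w → 1 ℕ.+ (t′ ℕ.* d ℕ.+ w)) tdu≡tud ⟩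
      1 ℕ.+ (t′ ℕ.* d ℕ.+ t ℕ.* u ℕ.* d)     ≡⟨ cong suc (ℕ.*-distribʳ-+ d t′ (t ℕ.* u)) ⟨
      1 ℕ.+ (t′ ℕ.+ t ℕ.* u) ℕ.* d           ∎)
    where
    open ≡-Reasoning
    open import Algebra.Properties.CommutativeSemigroup ℕ.*-commutativeSemigroup using (interchange)
    u = 1 ℕ.+ t′ ℕ.* d
    tdu≡tud : t ℕ.* d ℕ.* u ≡ t ℕ.* u ℕ.* d
    tdu≡tud = trans (ℕ.*-assoc t d u) (trans (cong (t ℕ.*_) (ℕ.*-comm d u)) (sym (ℕ.*-assoc t u d)))

  p∤d×a^lp^l≡1-mod-d : ∀ a p {d} → Prime p → 1 ℕ.≤ a → d ∣ a ℕ.* p ∸ 1 → ∀ l →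
    ¬ p ∣ d × ∃ λ t → a ^ l ℕ.* p ^ l ≡ 1 ℕ.+ t ℕ.* d
  p∤d×a^lp^l≡1-mod-d a p {d} pp 1≤a d∣ap∸1 l =
    ≡1+*d⇒∤d {a} {p} {t₀} {d} pp ap≡1+t₀d , ^-*-≡1+*d {a} {p} {t₀} {d} ap≡1+t₀d l
    where
    instance _ = prime⇒nonZero pp
    t₀,ap≡1+t₀d = ∣∸1⇒≡1+*d {a ℕ.* p} {d} (ℕ.*-mono-≤ 1≤a (ℕ.>-nonZero⁻¹ p)) d∣ap∸1
    t₀ = proj₁ t₀,ap≡1+t₀d
    ap≡1+t₀d = proj₂ t₀,ap≡1+t₀d

  parameters-admissible : ∀ {r s} (α : Fin r → ℚ) (β : Fin s → ℚ) →
    (∀ i → NotNonPosInt (α i)) → (∀ j → NotNonPosInt (β j)) →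
    let d = dαβ α β
        K = ℕtoℚ d * (maxAbs α ⊔ maxAbs β)
    in (∀ i → Admissible d K (α i)) × (∀ j → Admissible d K (β j))
  parameters-admissible α β α∉ℤ≤0 β∉ℤ≤0 =
    (λ i → admissible (ℕ.∣-trans (lcmF-∣ (↧ₙ_ ∘ α) i) (m∣lcm[m,n] (lcmF (↧ₙ_ ∘ α)) (lcmF (↧ₙ_ ∘ β)))) (α∉ℤ≤0 i)
             (ℚ.≤-trans (∣f∣≤maxAbs α i) (ℚ.p≤p⊔q (maxAbs α) (maxAbs β)))) ,
    (λ j → admissible (ℕ.∣-trans (lcmF-∣ (↧ₙ_ ∘ β) j) (n∣lcm[m,n] (lcmF (↧ₙ_ ∘ α)) (lcmF (↧ₙ_ ∘ β)))) (β∉ℤ≤0 j)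
             (ℚ.≤-trans (∣f∣≤maxAbs β j) (ℚ.p≤q⊔p (maxAbs α) (maxAbs β))))

  dQ+dQ<p^l : ∀ {r s} (α : Fin r → ℚ) (β : Fin s → ℚ) p .{{_ : NonZero p}} l → 1 ℕ.≤ l → Mαβ α β < ℕtoℚ p →
    ℕtoℚ (dαβ α β) * (maxAbs α ⊔ maxAbs β) + ℕtoℚ (dαβ α β) * (maxAbs α ⊔ maxAbs β) < ℕtoℚ (p ^ l)
  dQ+dQ<p^l α β p l 1≤l M<p = begin-strict
    dQ + dQ     ≤⟨ 0≤q-p⇒p≤q (subst (0ℚ ≤_) M-[dQ+dQ]≡2d (subst (0ℚ ≤_) (ℕtoℚ-* 2 d) (0≤ℕtoℚ (2 ℕ.* d)))) ⟩
    Mαβ α β     <⟨ M<p ⟩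
    ℕtoℚ p      ≤⟨ ι-mono-≤ (ℤ.+≤+ (subst (ℕ._≤ p ^ l) (ℕ.*-identityʳ p) (ℕ.^-monoʳ-≤ p 1≤l))) ⟩
    ℕtoℚ (p ^ l) ∎
    where
    open ℚ.≤-Reasoning
    d = dαβ α β
    Q = maxAbs α ⊔ maxAbs β
    dQ = ℕtoℚ d * Q
    M-[dQ+dQ]≡2d : ℕtoℚ 2 * ℕtoℚ d ≡ Mαβ α β - (dQ + dQ)
    M-[dQ+dQ]≡2d = solve 2 (λ d Q → con (ℕtoℚ 2) :* d := d :* (con (ℕtoℚ 2) :+ con (ℕtoℚ 2) :* Q) :- (d :* Q :+ d :* Q))
      refl (ℕtoℚ d) Q

open import Data.Nat using (_≤_)

lemma2p6 : ∀ {r s : ℕ} (α : Fin r → ℚ) (β : Fin s → ℚ)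
  → (∀ i → NotNonPosInt (α i)) → (∀ j → NotNonPosInt (β j))
  → (p : ℕ) .{{_ : NonZero p}} → Prime p → Mαβ α β < ℕtoℚ p
  → (l : ℕ) → 1 ≤ l
  → (a : ℕ) → 1 ≤ a → a ≤ dαβ α β → dαβ α β ∣ (a ℕ.* p ∸ 1)
  → let b = a ^ l
        D = dwork p l
        e = λ (γ : ℚ) → D γ - γ * invPow p l
        cond-i = ∀ (x : ℚ) → + 0 ℤ.≤ δ α β x b
        cond-ii = ∀ (k : Fin s) → + 0 ℤ.≤ δ α β (ℕtoℚ b * β k) b
        cond-iii = ∀ (k : Fin s) →
          count (λ j → lessEqᵇ (e (β j)) (e (β k)))
            ≤ count (λ i → lessEqᵇ (e (α i)) (e (β k)))
        cond-iv = ∀ (n : ℕ) → 1 ≤ n → n ≤ p ^ l →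
          count (λ j → lessEqᵇ (e (β j)) (ℕtoℚ n * invPow p l))
            ≤ count (λ i → lessEqᵇ (e (α i)) (ℕtoℚ n * invPow p l))
        cond-v = ∀ (n : ℕ) → 1 ≤ n → n ≤ p ^ l →
          sumℤ (λ j → ceiling ((ℕtoℚ n + β j) * invPow p l - D (β j)))
            ℤ.≤ sumℤ (λ i → ceiling ((ℕtoℚ n + α i) * invPow p l - D (α i)))
    in (cond-i ⇔ cond-ii) × (cond-i ⇔ cond-iii) × (cond-i ⇔ cond-iv) × (cond-i ⇔ cond-v)
lemma2p6 α β α∉ℤ≤0 β∉ℤ≤0 p pp M<p l 1≤l a 1≤a _ d∣ap∸1 =
  i⇔ii , i⇔iii , ⇔-trans i⇔iii iii⇔iv , ⇔-trans i⇔iii iii⇔v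
  where
  d = dαβ α β
  K = ℕtoℚ d * (maxAbs α ⊔ maxAbs β)
  mod-d = p∤d×a^lp^l≡1-mod-d a p pp 1≤a d∣ap∸1 l
  αβ-admissible = parameters-admissible α β α∉ℤ≤0 β∉ℤ≤0
  open Equivalences α β p pp l (a ^ l) d (proj₁ (proj₂ mod-d)) (proj₂ (proj₂ mod-d)) (proj₁ mod-d)
    K (dQ+dQ<p^l α β p l 1≤l M<p) (proj₁ αβ-admissible) (proj₂ αβ-admissible)
  i⇔ii = δ-nonneg⇔at-bβ α β (a ^ l)
  i⇔iii = ⇔-trans i⇔ii ii⇔iii
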